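{- Let $\mathcal{X}=\langle X;\preceq,\perp,\Omega,\mathcal{T}_X\rangle$ be an orthomodular space, and let $\omega$ be the top element of $\langle X;\preceq\rangle$. Then the algebra $\mathscr{A}_0(\mathcal{X})=\langle\mathcal{CO}(\mathcal{X})^{\dagger};\cap,{}^{\perp},\{\omega\}\rangle$ is an orthomodular lattice.
   Context: An ortholattice is an algebra $\langle A;\cdot,-,0\rangle$ such that $\langle A;\cdot,0\rangle$ is a meet-semilattice with least element $0$ (order $a\le b$ iff $a\cdot b=a$) and $-$ satisfies $a\cdot -a=0$, $a\le b\Rightarrow -b\le -a$, $a=--a$; joins are $a+b:=-(-a\cdot -b)$. An orthomodular lattice is an ortholattice satisfying $a\le b\Rightarrow b=a+(-a\cdot b)$. An orthomodular frame is a structure $\langle X;\preceq,\perp,\Omega\rangle$ with $\preceq,\perp\subseteq X\times X$ and $\Omega\subseteq X$ such that: (1) $\langle X;\preceq\rangle$ is a partially ordered meet-semilattice (write $x\cap y:=\inf\{x,y\}$ and ${\uparrow}x=\{y:x\preceq y\}$); (2) $\langle X;\preceq\rangle$ has an upper bound (top element) $\omega$ with $\omega\in\Omega$; (3) for every $x\in\Omega$ there is $z\in\Omega$ such that for all $y$, $x\perp y\Leftrightarrow z\preceq y$, and for all $u$, $z\perp u\Rightarrow x\preceq u$; (4) for all $x,y\in\Omega$: if $y\preceq x$ and for all $z$ ($y\preceq z$ and $z\perp x$ imply $z=\omega$), then $x=y$; (5) $x\perp x\Rightarrow x=\omega$; (6) $x,y\in\Omega\Rightarrow x\cap y\in\Omega$;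 (7) $x\perp\omega$ for all $x$; (8) $x\perp y\Rightarrow y\perp x$; (9) if $x\perp y$ and $x\preceq z$ then $z\perp y$. For $U\subseteq X$, $U^{\perp}:=\{x\in X: x\perp y\text{ for all }y\in U\}$; $U$ is $\perp$-stable if $U=U^{\perp\perp}$. $\mathcal{CO}(\mathcal{X})^{\dagger}$ is the set of subsets of $X$ that are clopen and $\perp$-stable. An orthomodular space is $\mathcal{X}=\langle X;\preceq,\perp,\Omega,\mathcal{T}_X\rangle$ such that: (1) $\langle X;\preceq,\perp,\Omega\rangle$ is an orthomodular frame; (2) $\langle X;\mathcal{T}_X\rangle$ is compact; (3) $\mathcal{CO}(\mathcal{X})^{\dagger}$ is closed under $\cap$ and ${}^{\perp}$; (4) each $U\in\mathcal{CO}(\mathcal{X})^{\dagger}$ equals ${\uparrow}z$ for some $z\in\Omega$; (5) if $x\not\preceq y$ there is $U\in\mathcal{CO}(\mathcal{X})^{\dagger}$ with $x\in U$, $y\notin U$; (6) if $x\perp y$ there is $U\in\mathcal{CO}(\mathcal{X})^{\dagger}$ with $x\in U$ and $y\in U^{\perp}$. -}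

module Defs where

open import Level using (Level; _⊔_) renaming (suc to lsuc; zero to lzero)
open import Data.Product using (Σ; _×_; _,_; proj₁; proj₂)
open import Data.List using (List)
open import Data.List.Membership.Propositional using (_∈_)
open import Data.Empty using (⊥)
open import Relation.Nullary using (¬_)
open import Relation.Binary.PropositionalEquality using (_≡_)
open import Relation.Binary.Structures using (IsPartialOrder)
open import Algebra.Core using (Op₁; Op₂)
open import Algebra.Lattice.Structures using (IsSemilattice)

Subset : Set → Set₁
Subset X = X → Set

module _ {X : Set} where

  _⊆_ : Subset X → Subset X → Set
  U ⊆ V = ∀ x → U x → V x

  _≐_ : Subset X → Subset X → Set
  U ≐ V = (U ⊆ V) × (V ⊆ U)

  _∩ˢ_ : Subset X → Subset X → Subset X
  (U ∩ˢ V) x = U x × V x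

  ∁ : Subset X → Subset X
  ∁ U x = ¬ U x

  ∅ˢ : Subset X
  ∅ˢ x = ⊥


record IsTopology (X : Set) (𝒯 : Subset X → Set) : Set₁ where
  field
    ext-open   : ∀ {U V} → U ≐ V → 𝒯 U → 𝒯 V
    empty-open : 𝒯 ∅ˢ
    whole-open : 𝒯 (λ _ → X)
    ∩-open     : ∀ {U V} → 𝒯 U → 𝒯 V → 𝒯 (U ∩ˢ V)
    ⋃-open     : (I : Set) (F : I → Subset X) → (∀ i → 𝒯 (F i)) →
                 𝒯 (λ x → Σ I (λ i → F i x))

IsCompact : (X : Set) → (Subset X → Set) → Set₁
IsCompact X 𝒯 =
  (I : Set) (F : I → Subset X) → (∀ i → 𝒯 (F i)) →
  (∀ x → Σ I (λ i → F i x)) →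
  Σ (List I) (λ is → ∀ x → Σ I (λ i → (i ∈ is) × F i x))

Clopen : {X : Set} → (Subset X → Set) → Subset X → Set
Clopen 𝒯 U = 𝒯 U × 𝒯 (∁ U)

record IsOrthomodularFrame (X : Set) (_≼_ : X → X → Set) (_⟂_ : X → X → Set)
                           (Ω : Subset X) : Set₁ where
  field
    isPartialOrder : IsPartialOrder _≡_ _≼_
    _∩_            : X → X → X
    ∩-lb₁          : ∀ x y → (x ∩ y) ≼ x
    ∩-lb₂          : ∀ x y → (x ∩ y) ≼ y
    ∩-glb          : ∀ x y z → z ≼ x → z ≼ y → z ≼ (x ∩ y)
    ω              : X
    ω-top          : ∀ x → x ≼ ω
    ω∈Ω            : Ω ω
    ax3 : ∀ x → Ω x → Σ X (λ z → Ω z ×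
            ((∀ y → ((x ⟂ y → z ≼ y) × (z ≼ y → x ⟂ y))) ×
             (∀ u → z ⟂ u → x ≼ u)))
    ax4 : ∀ x y → Ω x → Ω y → y ≼ x →
            (∀ z → y ≼ z → z ⟂ x → z ≡ ω) → x ≡ y
    ax5 : ∀ x → x ⟂ x → x ≡ ω
    ax6 : ∀ x y → Ω x → Ω y → Ω (x ∩ y)
    ax7 : ∀ x → x ⟂ ω
    ax8 : ∀ x y → x ⟂ y → y ⟂ x
    ax9 : ∀ x y z → x ⟂ y → x ≼ z → z ⟂ y

module _ {X : Set} (_⟂_ : X → X → Set) where

  orth : Subset X → Subset X
  orth U x = ∀ y → U y → x ⟂ y

  ⊥-stable : Subset X → Set
  ⊥-stable U = U ≐ orth (orth U)

CO† : {X : Set} → (Subset X → Set) → (X → X → Set) → Subset X → Set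
CO† 𝒯 _⟂_ U = Clopen 𝒯 U × ⊥-stable _⟂_ U

↑ : {X : Set} → (X → X → Set) → X → Subset X
↑ _≼_ x y = x ≼ y

record IsOrthomodularSpace (X : Set) (_≼_ : X → X → Set) (_⟂_ : X → X → Set)
                           (Ω : Subset X) (𝒯 : Subset X → Set) : Set₁ where
  field
    isFrame    : IsOrthomodularFrame X _≼_ _⟂_ Ω
    isTopology : IsTopology X 𝒯
    compact    : IsCompact X 𝒯
    CO†-∩      : ∀ U V → CO† 𝒯 _⟂_ U → CO† 𝒯 _⟂_ V → CO† 𝒯 _⟂_ (U ∩ˢ V)
    CO†-orth   : ∀ U → CO† 𝒯 _⟂_ U → CO† 𝒯 _⟂_ (orth _⟂_ U)
    CO†-principal : ∀ U → CO† 𝒯 _⟂_ U → Σ X (λ z → Ω z × (U ≐ ↑ _≼_ z))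
    separation : ∀ x y → ¬ (x ≼ y) →
                   Σ (Subset X) (λ U → CO† 𝒯 _⟂_ U × U x × ¬ U y)
    ⊥-separation : ∀ x y → x ⟂ y →
                   Σ (Subset X) (λ U → CO† 𝒯 _⟂_ U × U x × orth _⟂_ U y)

  open IsOrthomodularFrame isFrame public

record IsOrthomodularLattice {a ℓ : Level} {A : Set a} (_≈_ : A → A → Set ℓ)
                             (_·_ : Op₂ A) (-_ : Op₁ A) (0# : A) : Set (a ⊔ ℓ) where
  _≤_ : A → A → Set ℓ
  x ≤ y = (x · y) ≈ x
  _+_ : A → A → A
  x + y = - ((- x) · (- y))
  field
    isSemilattice : IsSemilattice _≈_ _·_
    neg-cong      : ∀ {x y} → x ≈ y → (- x) ≈ (- y)
    zero-least    : ∀ x → 0# ≤ x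
    compl         : ∀ x → (x · (- x)) ≈ 0#
    antitone      : ∀ x y → x ≤ y → (- y) ≤ (- x)
    involutive    : ∀ x → x ≈ (- (- x))
    orthomodular  : ∀ x y → x ≤ y → y ≈ (x + ((- x) · y))

module A₀ {X : Set} {_≼_ _⟂_ : X → X → Set} {Ω : Subset X} {𝒯 : Subset X → Set}
          (S : IsOrthomodularSpace X _≼_ _⟂_ Ω 𝒯) where
  open IsOrthomodularSpace S

  Carrier : Set₁
  Carrier = Σ (Subset X) (CO† 𝒯 _⟂_)

  _≈_ : Carrier → Carrier → Set
  U ≈ V = proj₁ U ≐ proj₁ V

  meet : Carrier → Carrier → Carrier
  meet (U , p) (V , q) = (U ∩ˢ V) , CO†-∩ U V p q

  neg : Carrier → Carrier
  neg (U , p) = orth _⟂_ U , CO†-orth U p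

  singletonω : Subset X
  singletonω x = x ≡ ω

-- The lattice part is pure bookkeeping: meets are intersections, ⊥-stable
-- sets contain ω and are fixed by ᗮᗮ. Orthomodularity is the real content.
-- For U ⊆ V put J = U + (Uᗮ ∩ V); then J ⊆ V since V is ⊥-stable, and an
-- element of V orthogonal to J lies both in Uᗮ ∩ V and in its
-- orthocomplement, hence is ω. As J = ↑j and V = ↑v with j, v ∈ Ω, axiom (4)
-- of the frame turns this into j = v, i.e. V = J.
module Submission where

open import Defs
open import Data.Product using (Σ; _,_; proj₁; proj₂)
open import Relation.Binary.PropositionalEquality using (_≡_; refl; sym; subst)
open import Relation.Binary.Structures using (IsPartialOrder; IsEquivalence)
open import Algebra.Structures using (IsCommutativeBand)
open import Algebra.Lattice.Structures using (IsSemilattice)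
open import Algebra.Morphism.Structures using (IsMagmaMonomorphism)
import Algebra.Morphism.MagmaMonomorphism as MagmaMonomorphism

module _ {X : Set} where

  ⊆-refl : {U : Subset X} → U ⊆ U
  ⊆-refl x u = u

  ⊆-trans : {U V W : Subset X} → U ⊆ V → V ⊆ W → U ⊆ W
  ⊆-trans U⊆V V⊆W x u = V⊆W x (U⊆V x u)

  ≐-isEquivalence : IsEquivalence (_≐_ {X})
  ≐-isEquivalence = record
    { refl  = ⊆-refl , ⊆-refl
    ; sym   = λ (U⊆V , V⊆U) → V⊆U , U⊆V
    ; trans = λ (U⊆V , V⊆U) (V⊆W , W⊆V) → ⊆-trans U⊆V V⊆W , ⊆-trans W⊆V V⊆U
    }

  open IsEquivalence ≐-isEquivalence public
    using () renaming (refl to ≐-refl; sym to ≐-sym; trans to ≐-trans)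

  ∁-cong : {U V : Subset X} → U ≐ V → ∁ U ≐ ∁ V
  ∁-cong (U⊆V , V⊆U) = (λ x ¬u v → ¬u (V⊆U x v)) , (λ x ¬v u → ¬v (U⊆V x u))

  ∩ˢ-isSemilattice : IsSemilattice (_≐_ {X}) _∩ˢ_
  ∩ˢ-isSemilattice = record
    { isBand = record
      { isSemigroup = record
        { isMagma = record
          { isEquivalence = ≐-isEquivalence
          ; ∙-cong = λ (U⊆V , V⊆U) (W⊆Z , Z⊆W) →
              (λ x (u , w) → U⊆V x u , W⊆Z x w) , (λ x (v , z) → V⊆U x v , Z⊆W x z)
          }
        ; assoc = λ U V W →
            (λ x ((u , v) , w) → u , (v , w)) , (λ x (u , (v , w)) → (u , v) , w)
        }
      ; idem = λ U → (λ x (u , _) → u) , (λ x u → u , u)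
      }
    ; comm = λ U V → (λ x (u , v) → v , u) , (λ x (v , u) → u , v)
    }

  ∩ˢ-≐ˡ⇒⊆ : {U V : Subset X} → (U ∩ˢ V) ≐ U → U ⊆ V
  ∩ˢ-≐ˡ⇒⊆ (_ , U⊆U∩V) x u = proj₂ (U⊆U∩V x u)

  ⊆⇒∩ˢ-≐ˡ : {U V : Subset X} → U ⊆ V → (U ∩ˢ V) ≐ U
  ⊆⇒∩ˢ-≐ˡ U⊆V = (λ x (u , _) → u) , (λ x u → u , U⊆V x u)

module Orth {X : Set} (_⟂_ : X → X → Set) where

  infix 30 _ᗮ
  _ᗮ : Subset X → Subset X
  _ᗮ = orth _⟂_

  join : Subset X → Subset X → Subset X
  join U V = ((U ᗮ) ∩ˢ (V ᗮ)) ᗮ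

  orth-antitone : {U V : Subset X} → U ⊆ V → V ᗮ ⊆ U ᗮ
  orth-antitone U⊆V x x⟂V y u = x⟂V y (U⊆V y u)

  orth-cong : {U V : Subset X} → U ≐ V → U ᗮ ≐ V ᗮ
  orth-cong (U⊆V , V⊆U) = orth-antitone V⊆U , orth-antitone U⊆V

  ⊥-stable-cong : {U V : Subset X} → U ≐ V → ⊥-stable _⟂_ U → ⊥-stable _⟂_ V
  ⊥-stable-cong U≐V U-stable =
    ≐-trans (≐-sym U≐V) (≐-trans U-stable (orth-cong (orth-cong U≐V)))

  join-least : {U W V : Subset X} → ⊥-stable _⟂_ V → U ⊆ V → W ⊆ V → join U W ⊆ V
  join-least (_ , Vᗮᗮ⊆V) U⊆V W⊆V =
    ⊆-trans (orth-antitone (λ x x⟂V → orth-antitone U⊆V x x⟂V , orth-antitone W⊆V x x⟂V))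
            Vᗮᗮ⊆V

module OrthomodularFrame {X : Set} {_≼_ _⟂_ : X → X → Set} {Ω : Subset X}
    (F : IsOrthomodularFrame X _≼_ _⟂_ Ω) where
  open IsOrthomodularFrame F
  open Orth _⟂_

  singletonω : Subset X
  singletonω x = x ≡ ω

  ω-⟂ : ∀ y → ω ⟂ y
  ω-⟂ y = ax8 y ω (ax7 y)

  ⟂-upward : ∀ {x y z} → x ⟂ y → y ≼ z → x ⟂ z
  ⟂-upward x⟂y y≼z = ax8 _ _ (ax9 _ _ _ (ax8 _ _ x⟂y) y≼z)

  ⟂⇒orth-↑ : ∀ {z j} → z ⟂ j → (↑ _≼_ j ᗮ) z
  ⟂⇒orth-↑ z⟂j t j≼t = ⟂-upward z⟂j j≼t

  ⊆-orth-orth : {U : Subset X} → U ⊆ (U ᗮ) ᗮ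
  ⊆-orth-orth x u y y⟂U = ax8 y x (y⟂U x u)

  ⊆-joinˡ : {U W : Subset X} → U ⊆ join U W
  ⊆-joinˡ = ⊆-trans ⊆-orth-orth (orth-antitone (λ x → proj₁))

  ⊆-joinʳ : {U W : Subset X} → W ⊆ join U W
  ⊆-joinʳ = ⊆-trans ⊆-orth-orth (orth-antitone (λ x → proj₂))

  ∩-orth-⊆-singletonω : {U : Subset X} → (U ∩ˢ (U ᗮ)) ⊆ singletonω
  ∩-orth-⊆-singletonω x (u , x⟂U) = ax5 x (x⟂U x u)

  ⊥-stable-∋ω : {U : Subset X} → ⊥-stable _⟂_ U → U ω
  ⊥-stable-∋ω (_ , Uᗮᗮ⊆U) = Uᗮᗮ⊆U ω (λ y _ → ω-⟂ y)

  whole : Subset X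
  whole _ = X

  whole-⊥-stable : ⊥-stable _⟂_ whole
  whole-⊥-stable = (λ x _ y y⟂X → subst (x ⟂_) (sym (ax5 y (y⟂X y y))) (ax7 x)) , (λ x _ → x)

  orth-whole≐singletonω : whole ᗮ ≐ singletonω
  orth-whole≐singletonω = (λ x x⟂X → ax5 x (x⟂X x x)) , (λ { x refl y _ → ω-⟂ y })

  -- Axiom (4) read on principal up-sets.
  ↑-⊇-of-trivial-relative-orth : ∀ {j v} → Ω j → Ω v → ↑ _≼_ j ⊆ ↑ _≼_ v →
    (↑ _≼_ v ∩ˢ (↑ _≼_ j ᗮ)) ⊆ singletonω → ↑ _≼_ v ⊆ ↑ _≼_ j
  ↑-⊇-of-trivial-relative-orth {j} {v} Ωj Ωv ↑j⊆↑v trivial x v≼x =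
    subst (_≼ x) (sym j≡v) v≼x
    where
    j≡v : j ≡ v
    j≡v = ax4 j v Ωj Ωv (↑j⊆↑v j (IsPartialOrder.refl isPartialOrder))
                (λ z v≼z z⟂j → trivial z (v≼z , ⟂⇒orth-↑ z⟂j))

  -- In V, the elements orthogonal to U + (Uᗮ ∩ V) lie in Uᗮ ∩ V and in its orthocomplement.
  relative-orth-of-join-trivial : {U V : Subset X} →
    (V ∩ˢ (join U ((U ᗮ) ∩ˢ V) ᗮ)) ⊆ singletonω
  relative-orth-of-join-trivial {U} {V} x (v , x⟂J) = ∩-orth-⊆-singletonω x (x∈W , x⟂W)
    where
    x∈W : ((U ᗮ) ∩ˢ V) x
    x∈W = orth-antitone ⊆-joinˡ x x⟂J , v
    x⟂W : (((U ᗮ) ∩ˢ V) ᗮ) x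
    x⟂W = orth-antitone (⊆-joinʳ {U}) x x⟂J

module OrthomodularSpace {X : Set} {_≼_ _⟂_ : X → X → Set} {Ω : Subset X}
    {𝒯 : Subset X → Set} (S : IsOrthomodularSpace X _≼_ _⟂_ Ω 𝒯) where
  open IsOrthomodularSpace S
  open IsTopology isTopology
  open Orth _⟂_
  open OrthomodularFrame isFrame
  open A₀ S using (_≈_; meet; neg)

  CO†-cong : {U V : Subset X} → U ≐ V → CO† 𝒯 _⟂_ U → CO† 𝒯 _⟂_ V
  CO†-cong U≐V ((U-open , ∁U-open) , U-stable) =
    (ext-open U≐V U-open , ext-open (∁-cong U≐V) ∁U-open) , ⊥-stable-cong U≐V U-stable

  CO†-whole : CO† 𝒯 _⟂_ whole
  CO†-whole = (whole-open , ext-open ((λ _ ()) , (λ x ¬x → ¬x x)) empty-open) , whole-⊥-stable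

  CO†-singletonω : CO† 𝒯 _⟂_ singletonω
  CO†-singletonω = CO†-cong orth-whole≐singletonω (CO†-orth whole CO†-whole)

  CO†-⊇-of-trivial-relative-orth : {U V : Subset X} → CO† 𝒯 _⟂_ U → CO† 𝒯 _⟂_ V →
    U ⊆ V → (V ∩ˢ (U ᗮ)) ⊆ singletonω → V ⊆ U
  CO†-⊇-of-trivial-relative-orth {U} {V} U∈CO† V∈CO† U⊆V trivial
    with CO†-principal U U∈CO† | CO†-principal V V∈CO†
  ... | u , Ωu , (U⊆↑u , ↑u⊆U) | v , Ωv , (V⊆↑v , ↑v⊆V) =
    ⊆-trans V⊆↑v (⊆-trans ↑v⊆↑u ↑u⊆U)
    where
    ↑v⊆↑u : ↑ _≼_ v ⊆ ↑ _≼_ u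
    ↑v⊆↑u = ↑-⊇-of-trivial-relative-orth Ωu Ωv (⊆-trans ↑u⊆U (⊆-trans U⊆V V⊆↑v))
              (λ x (v≼x , x⟂↑u) → trivial x (↑v⊆V x v≼x , orth-antitone U⊆↑u x x⟂↑u))

  orthomodular-law : {U V : Subset X} → CO† 𝒯 _⟂_ U → CO† 𝒯 _⟂_ V →
    U ⊆ V → V ≐ join U ((U ᗮ) ∩ˢ V)
  orthomodular-law {U} {V} U∈CO† V∈CO† U⊆V = V⊆J , J⊆V
    where
    W : Subset X
    W = (U ᗮ) ∩ˢ V
    J : Subset X
    J = join U W
    W∈CO† : CO† 𝒯 _⟂_ W
    W∈CO† = CO†-∩ (U ᗮ) V (CO†-orth U U∈CO†) V∈CO†
    J∈CO† : CO† 𝒯 _⟂_ J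
    J∈CO† = CO†-orth _ (CO†-∩ _ _ (CO†-orth U U∈CO†) (CO†-orth W W∈CO†))
    J⊆V : J ⊆ V
    J⊆V = join-least (proj₂ V∈CO†) U⊆V (λ x → proj₂)
    V⊆J : V ⊆ J
    V⊆J = CO†-⊇-of-trivial-relative-orth J∈CO† V∈CO† J⊆V relative-orth-of-join-trivial

  proj₁-isMagmaMonomorphism :
    IsMagmaMonomorphism (record { _≈_ = _≈_ ; _∙_ = meet })
                        (record { _≈_ = _≐_ ; _∙_ = _∩ˢ_ }) proj₁
  proj₁-isMagmaMonomorphism = record
    { isMagmaHomomorphism = record
      { isRelHomomorphism = record { cong = λ U≈V → U≈V }
      ; homo              = λ U V → ≐-refl
      }
    ; injective = λ U≐V → U≐V
    }

  A₀-isOrthomodularLattice : IsOrthomodularLattice _≈_ meet neg (singletonω , CO†-singletonω)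
  A₀-isOrthomodularLattice = record
    { isSemilattice = record
      { isBand = Mono.isBand isBand
      ; comm   = Mono.comm isMagma comm
      }
    ; neg-cong     = orth-cong
    ; zero-least   = λ (U , U∈CO†) → ⊆⇒∩ˢ-≐ˡ λ { x refl → ⊥-stable-∋ω (proj₂ U∈CO†) }
    ; compl        = λ U → ∩-orth-⊆-singletonω ,
                           (λ { x refl → ⊥-stable-∋ω (proj₂ (proj₂ U)) , (λ y _ → ω-⟂ y) })
    ; antitone     = λ U V U≤V → ⊆⇒∩ˢ-≐ˡ (orth-antitone (∩ˢ-≐ˡ⇒⊆ U≤V))
    ; involutive   = λ U → proj₂ (proj₂ U)
    ; orthomodular = λ U V U≤V → orthomodular-law (proj₂ U) (proj₂ V) (∩ˢ-≐ˡ⇒⊆ U≤V)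
    }
    where
    open IsCommutativeBand ∩ˢ-isSemilattice using (isBand; isMagma; comm)
    module Mono = MagmaMonomorphism proj₁-isMagmaMonomorphism

lemma3p8 : {X : Set} {_≼_ _⟂_ : X → X → Set} {Ω : Subset X} {𝒯 : Subset X → Set}
    (S : IsOrthomodularSpace X _≼_ _⟂_ Ω 𝒯) →
    Σ (CO† 𝒯 _⟂_ (A₀.singletonω S))
    (λ p → IsOrthomodularLattice (A₀._≈_ S) (A₀.meet S) (A₀.neg S)
    (A₀.singletonω S , p))
lemma3p8 S = CO†-singletonω , A₀-isOrthomodularLattice
  where open OrthomodularSpace S
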